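{- Let $n\ge 2$ and let $\mathcal{P}$ be the subposet of the Boolean lattice $B_n$ (all subsets of $[n]=\{1,\dots,n\}$ ordered by inclusion) induced by a family of subsets of $[n]$ that contains all singletons $\{i\}$ and all sets $[n]\setminus\{i\}$, $i=1,\dots,n$. Then the critical pairs of $\mathcal{P}$ are exactly the pairs $(\{i\},[n]\setminus\{i\})$, $i=1,\dots,n$.
   Context: For an element $u$ of a poset let $\downarrow u$ (resp. $\uparrow u$) be the set of elements strictly smaller (resp. strictly larger) than $u$. An ordered pair $(u,v)$ of elements is a critical pair if $u$ and $v$ are incomparable, $\downarrow u\subseteq\downarrow v$ and $\uparrow v\subseteq\uparrow u$. -}

module Defs where

open import Data.Nat using (ℕ)
open import Data.Fin using (Fin)
open import Data.Fin.Subset using (Subset; _⊆_; _⊂_; ⁅_⁆; ∁)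
open import Data.Product using (_×_; ∃)
open import Relation.Nullary using (¬_)
open import Relation.Binary.PropositionalEquality using (_≡_)

-- The induced subposet of B_n has elements the members of 𝓕, ordered by ⊆.

-- ↓u ⊆ ↓v  (strict down-sets inside the subposet)
DownIncl : ∀ {n} → (Subset n → Set) → Subset n → Subset n → Set
DownIncl 𝓕 u v = ∀ w → 𝓕 w → w ⊂ u → w ⊂ v

-- ↑v ⊆ ↑u  (strict up-sets inside the subposet)
UpIncl : ∀ {n} → (Subset n → Set) → Subset n → Subset n → Set
UpIncl 𝓕 u v = ∀ w → 𝓕 w → v ⊂ w → u ⊂ w

Incomparable : ∀ {n} → Subset n → Subset n → Set
Incomparable u v = ¬ (u ⊆ v) × ¬ (v ⊆ u)

-- (u , v) is a critical pair of the subposet induced by 𝓕 (u, v assumed in 𝓕)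
IsCriticalPair : ∀ {n} → (Subset n → Set) → Subset n → Subset n → Set
IsCriticalPair 𝓕 u v = Incomparable u v × DownIncl 𝓕 u v × UpIncl 𝓕 u v

-- Take x ∈ u ∖ v. If ⁅ x ⁆ were strictly below u, the down-set condition would put
-- ⁅ x ⁆ strictly below v, so x ∈ v; hence u = ⁅ x ⁆. Dually v ⊆ ∁ ⁅ x ⁆, and if the
-- inclusion were strict the up-set condition would give u ⊂ ∁ ⁅ x ⁆, contradicting
-- x ∈ u; hence v = ∁ ⁅ x ⁆. Conversely, only ∅ lies strictly below ⁅ x ⁆ and only
-- sets containing x lie strictly above ∁ ⁅ x ⁆, which makes (⁅ x ⁆ , ∁ ⁅ x ⁆) a
-- critical pair of any subposet containing it, as soon as n ≥ 2.
module Submission where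

open import Defs
open import Data.Nat using (ℕ; _≤_; _≥_; s≤s)
open import Data.Fin using (Fin; zero; suc)
open import Data.Fin.Subset
  using (Subset; ⁅_⁆; ∁; _∈_; _∉_; _⊆_; _⊈_; _⊂_; Empty; Nonempty)
open import Data.Fin.Subset.Properties
  using (_∈?_; _⊆?_; ⊆-antisym; x∈⁅x⁆; x∈⁅y⁆⇒x≡y; x≢y⇒x∉⁅y⁆; x∈∁p⇒x∉p; x∉p⇒x∈∁p)
open import Data.Fin.Properties using (¬∀⟶∃¬)
open import Data.Product using (_×_; ∃; _,_; proj₁)
open import Data.Sum using (_⊎_; inj₁; inj₂)
open import Data.Empty using (⊥-elim)
open import Function using (_∘_; const)
open import Function.Bundles using (_⇔_; mk⇔)
open import Relation.Nullary using (yes; no)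
open import Relation.Nullary.Decidable using (_→-dec_; decidable-stable)
open import Relation.Binary.PropositionalEquality using (_≡_; refl; sym; trans; subst)

private
  variable
    n : ℕ
    p q u v : Subset n
    x : Fin n

⊈⇒∃∈∉ : p ⊈ q → ∃ λ x → x ∈ p × x ∉ q
⊈⇒∃∈∉ {n} {p} {q} p⊈q with ¬∀⟶∃¬ n _ (λ x → x ∈? p →-dec x ∈? q) (λ p⊆q → p⊈q (p⊆q _))
... | x , x∈p↛x∈q =
  x , decidable-stable (x ∈? p) (λ x∉p → x∈p↛x∈q (⊥-elim ∘ x∉p)) , x∈p↛x∈q ∘ const

⊆⇒≡⊎⊂ : p ⊆ q → p ≡ q ⊎ p ⊂ q
⊆⇒≡⊎⊂ {p = p} {q} p⊆q with q ⊆? p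
... | yes q⊆p = inj₁ (⊆-antisym p⊆q q⊆p)
... | no  q⊈p = inj₂ (p⊆q , ⊈⇒∃∈∉ q⊈p)

x∈p⇒⁅x⁆⊆p : x ∈ p → ⁅ x ⁆ ⊆ p
x∈p⇒⁅x⁆⊆p {x = x} x∈p y∈⁅x⁆ = subst (_∈ _) (sym (x∈⁅y⁆⇒x≡y x y∈⁅x⁆)) x∈p

x∉p⇒p⊆∁⁅x⁆ : x ∉ p → p ⊆ ∁ ⁅ x ⁆
x∉p⇒p⊆∁⁅x⁆ {x = x} x∉p y∈p =
  x∉p⇒x∈∁p (λ y∈⁅x⁆ → x∉p (subst (_∈ _) (x∈⁅y⁆⇒x≡y x y∈⁅x⁆) y∈p))

p⊂⁅x⁆⇒Empty : p ⊂ ⁅ x ⁆ → Empty p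
p⊂⁅x⁆⇒Empty {x = x} (p⊆⁅x⁆ , y , y∈⁅x⁆ , y∉p) (z , z∈p) =
  y∉p (subst (_∈ _) (trans (x∈⁅y⁆⇒x≡y x (p⊆⁅x⁆ z∈p)) (sym (x∈⁅y⁆⇒x≡y x y∈⁅x⁆))) z∈p)

Empty⇒⊂ : Empty p → Nonempty q → p ⊂ q
Empty⇒⊂ p-empty (y , y∈q) =
  (λ {z} z∈p → ⊥-elim (p-empty (z , z∈p))) , y , y∈q , λ y∈p → p-empty (y , y∈p)

∁⁅x⁆⊂p⇒x∈p : ∁ ⁅ x ⁆ ⊂ p → x ∈ p
∁⁅x⁆⊂p⇒x∈p {x = x} (_ , y , y∈p , y∉∁⁅x⁆) with y ∈? ⁅ x ⁆
... | yes y∈⁅x⁆ = subst (_∈ _) (x∈⁅y⁆⇒x≡y x y∈⁅x⁆) y∈p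
... | no  y∉⁅x⁆ = ⊥-elim (y∉∁⁅x⁆ (x∉p⇒x∈∁p y∉⁅x⁆))

∁⁅x⁆-nonempty : 2 ≤ n → (x : Fin n) → Nonempty (∁ ⁅ x ⁆)
∁⁅x⁆-nonempty (s≤s (s≤s _)) zero    = suc zero , x∉p⇒x∈∁p (x≢y⇒x∉⁅y⁆ {y = zero} λ ())
∁⁅x⁆-nonempty (s≤s (s≤s _)) (suc x) = zero     , x∉p⇒x∈∁p (x≢y⇒x∉⁅y⁆ {y = suc x} λ ())

DownIncl⇒≡⁅x⁆ : (𝓕 : Subset n → Set) → 𝓕 ⁅ x ⁆ →
                x ∈ u → x ∉ v → DownIncl 𝓕 u v → u ≡ ⁅ x ⁆
DownIncl⇒≡⁅x⁆ {x = x} 𝓕 𝓕⁅x⁆ x∈u x∉v down with ⊆⇒≡⊎⊂ (x∈p⇒⁅x⁆⊆p x∈u)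
... | inj₁ ⁅x⁆≡u = sym ⁅x⁆≡u
... | inj₂ ⁅x⁆⊂u = ⊥-elim (x∉v (proj₁ (down ⁅ x ⁆ 𝓕⁅x⁆ ⁅x⁆⊂u) (x∈⁅x⁆ x)))

UpIncl⇒≡∁⁅x⁆ : (𝓕 : Subset n → Set) → 𝓕 (∁ ⁅ x ⁆) →
               x ∈ u → x ∉ v → UpIncl 𝓕 u v → v ≡ ∁ ⁅ x ⁆
UpIncl⇒≡∁⁅x⁆ {x = x} 𝓕 𝓕∁⁅x⁆ x∈u x∉v up with ⊆⇒≡⊎⊂ (x∉p⇒p⊆∁⁅x⁆ x∉v)
... | inj₁ v≡∁⁅x⁆ = v≡∁⁅x⁆
... | inj₂ v⊂∁⁅x⁆ = ⊥-elim (x∈∁p⇒x∉p (proj₁ (up (∁ ⁅ x ⁆) 𝓕∁⁅x⁆ v⊂∁⁅x⁆) x∈u) (x∈⁅x⁆ x))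

critical⇒≡⁅x⁆×≡∁⁅x⁆ : (𝓕 : Subset n → Set) → (∀ i → 𝓕 ⁅ i ⁆) → (∀ i → 𝓕 (∁ ⁅ i ⁆)) →
                      IsCriticalPair 𝓕 u v → ∃ λ x → u ≡ ⁅ x ⁆ × v ≡ ∁ ⁅ x ⁆
critical⇒≡⁅x⁆×≡∁⁅x⁆ 𝓕 𝓕⁅_⁆ 𝓕∁⁅_⁆ ((u⊈v , _) , down , up) with ⊈⇒∃∈∉ u⊈v
... | x , x∈u , x∉v =
  x , DownIncl⇒≡⁅x⁆ 𝓕 𝓕⁅ x ⁆ x∈u x∉v down , UpIncl⇒≡∁⁅x⁆ 𝓕 𝓕∁⁅ x ⁆ x∈u x∉v up

⁅x⁆-∁⁅x⁆-critical : 2 ≤ n → (𝓕 : Subset n → Set) → (x : Fin n) →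
                    IsCriticalPair 𝓕 ⁅ x ⁆ (∁ ⁅ x ⁆)
⁅x⁆-∁⁅x⁆-critical n≥2 𝓕 x with ∁⁅x⁆-nonempty n≥2 x
... | y , y∈∁⁅x⁆ =
    ( (λ ⁅x⁆⊆∁⁅x⁆ → x∈∁p⇒x∉p (⁅x⁆⊆∁⁅x⁆ (x∈⁅x⁆ x)) (x∈⁅x⁆ x))
    , (λ ∁⁅x⁆⊆⁅x⁆ → x∈∁p⇒x∉p y∈∁⁅x⁆ (∁⁅x⁆⊆⁅x⁆ y∈∁⁅x⁆)) )
  , (λ w _ w⊂⁅x⁆ → Empty⇒⊂ (p⊂⁅x⁆⇒Empty w⊂⁅x⁆) (y , y∈∁⁅x⁆))
  , (λ w _ ∁⁅x⁆⊂w →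
       x∈p⇒⁅x⁆⊆p (∁⁅x⁆⊂p⇒x∈p ∁⁅x⁆⊂w) , y , proj₁ ∁⁅x⁆⊂w y∈∁⁅x⁆ , x∈∁p⇒x∉p y∈∁⁅x⁆)

mainTheorem8 : (n : ℕ) → n ≥ 2 → (𝓕 : Subset n → Set) →
               (∀ i → 𝓕 ⁅ i ⁆) → (∀ i → 𝓕 (∁ ⁅ i ⁆)) →
               ∀ u v → 𝓕 u → 𝓕 v →
               IsCriticalPair 𝓕 u v ⇔ (∃ λ (i : Fin n) → u ≡ ⁅ i ⁆ × v ≡ ∁ ⁅ i ⁆)
mainTheorem8 n n≥2 𝓕 𝓕⁅_⁆ 𝓕∁⁅_⁆ u v _ _ =
  mk⇔ (critical⇒≡⁅x⁆×≡∁⁅x⁆ 𝓕 𝓕⁅_⁆ 𝓕∁⁅_⁆)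
      (λ { (x , refl , refl) → ⁅x⁆-∁⁅x⁆-critical n≥2 𝓕 x })
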